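{- Let $x$ be a positive integer, let $n_1,n_2,m,k$ be positive integers and $j$ a nonnegative integer. Suppose $n_1=a_1b$ and $n_2=a_2b$ for a positive integer $b$, where $a_1$ (resp. $a_2$) is the largest divisor of $n_1$ (resp. $n_2$) with $\gcd(a_1,m)=1$ (resp. $\gcd(a_2,m)=1$). Then $$\frac{I(x,n_1m^k)}{I(x,n_1m^j)}=\frac{I(x,n_2m^k)}{I(x,n_2m^j)}.$$
   Context: For positive integers $x,n$, $\sigma_x(n)=\sum_{d\mid n} d^x$ and $I(x,n)=\sigma_x(n)/n^x$. -}

module Defs where

open import Data.Nat as ℕ using (ℕ; suc; _^_; _≤_)
open import Data.Nat.Divisibility using (_∣_; _∣?_)
open import Data.Nat.Coprimality using (Coprime)
open import Data.List using (List; filter; map; applyUpTo)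
open import Data.Nat.ListAction using (sum)
open import Data.Integer using (+_)
open import Data.Rational as ℚ using (ℚ; _÷_; 0ℚ; _/_; _≟_; ≢-nonZero)
open import Data.Product using (_×_)
open import Relation.Nullary using (yes; no)

-- divisors of n, as the list of d ∈ {1,…,n} with d ∣ n (correct for n ≥ 1)
divisors : ℕ → List ℕ
divisors n = filter (λ d → d ∣? n) (applyUpTo suc n)

σ : ℕ → ℕ → ℕ
σ x n = sum (map (λ d → d ^ x) (divisors n))

-- total division on ℚ (value 0 when the divisor is 0; only used with nonzero divisors)
_÷ₜ_ : ℚ → ℚ → ℚ
p ÷ₜ q with q ≟ 0ℚ
... | yes _  = 0ℚ
... | no q≢0 = _÷_ p q {{≢-nonZero q≢0}}

infixl 7 _÷ₜ_

⟦_⟧ : ℕ → ℚ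
⟦ n ⟧ = (+ n) / 1

I : ℕ → ℕ → ℚ
I x n = ⟦ σ x n ⟧ ÷ₜ ⟦ n ^ x ⟧

IsLargestCoprimeDivisor : ℕ → ℕ → ℕ → Set
IsLargestCoprimeDivisor a n m =
  a ∣ n × Coprime a m × (∀ d → d ∣ n → Coprime d m → d ≤ a)

module Submission where

-- Write n mᵗ = a · c_t with c_t = b mᵗ, where a is the largest
-- divisor of n = a b coprime to m.  Maximality of a forces gcd(a, b) = 1,
-- hence a is coprime to every c_t.  Since σ_x is multiplicative on coprime
-- arguments and (uv)ˣ = uˣ vˣ,
--     I(x, n mᵗ) = σ_x(a) σ_x(c_t) / (aˣ c_tˣ),
-- and in the quotient of the values at t = k and t = j the factor σ_x(a)/aˣ
-- cancels: the quotient is σ_x(c_k) c_jˣ / (c_kˣ σ_x(c_j)), which depends on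
-- b, m, k, j, x only.

open import Defs
open import Data.Empty using (⊥-elim)
open import Data.Integer as ℤ using (+_; +[1+_]; -[1+_])
import Data.Integer.Properties as ℤ
open import Data.List using (List; []; _∷_; map; applyUpTo; cartesianProduct; _++_)
open import Data.List.Membership.Propositional using (_∈_)
open import Data.List.Membership.Propositional.Properties
  using (∈-filter⁺; ∈-filter⁻; ∈-applyUpTo⁺; ∈-map⁺; ∈-map⁻;
         ∈-cartesianProduct⁺; ∈-cartesianProduct⁻)
open import Data.List.Membership.Propositional.Properties.WithK using (unique∧set⇒bag)
open import Data.List.Properties using (map-++; map-∘; map-cong)
open import Data.List.Relation.Binary.BagAndSetEquality using (∼bag⇒↭)
open import Data.List.Relation.Binary.Permutation.Propositional using (_↭_)
open import Data.List.Relation.Binary.Permutation.Propositional.Properties using (map⁺)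
import Data.List.Relation.Unary.All as All
import Data.List.Relation.Unary.All.Properties as All
open import Data.List.Relation.Unary.Any using (here; there)
open import Data.List.Relation.Unary.AllPairs using ([]; _∷_)
open import Data.List.Relation.Unary.Unique.Propositional using (Unique)
import Data.List.Relation.Unary.Unique.Propositional.Properties as Unique
open import Data.Nat using (ℕ; zero; suc; _+_; _*_; _^_; _≤_; _<_; _≥_; z≤n; s≤s; pred;
  NonZero; >-nonZero; ≢-nonZero)
open import Data.Nat.Coprimality as Coprimality using (Coprime; coprime-divisor; gcd≡1⇒coprime)
open import Data.Nat.Divisibility
open import Data.Nat.GCD using (gcd; gcd[m,n]∣m; gcd[m,n]∣n; gcd[m,n]≢0; c*gcd[m,n]≡gcd[cm,cn])
open import Data.Nat.ListAction using (sum)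
open import Data.Nat.ListAction.Properties using (sum-↭; sum-++)
open import Data.Nat.Properties
open import Algebra.Properties.CommutativeSemigroup *-commutativeSemigroup
  using (interchange)
open import Data.Nat.Solver using (module +-*-Solver)
open import Data.Product using (_×_; _,_; proj₁; proj₂; Σ-syntax; uncurry)
open import Data.Rational using (ℚ; mkℚ; 0ℚ; toℚᵘ; 1/_)
import Data.Rational as ℚ
open import Data.Rational.Properties using (toℚᵘ-fromℚᵘ; toℚᵘ-homo-*; toℚᵘ-injective)
open import Data.Rational.Unnormalised using (mkℚᵘ; _≃_; *≡*)
import Data.Rational.Unnormalised.Properties as ℚᵘ
open import Data.Sum using (inj₁; inj₂)
open import Function using (_∘_; mk⇔)
open import Relation.Binary.PropositionalEquality
open import Relation.Nullary using (yes; no)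

open ≡-Reasoning

pos-* : ∀ {u v} → 0 < u → 0 < v → 0 < u * v
pos-* {u} {v} = *-mono-< {0} {u} {0} {v}

pos-^ : ∀ {u} t → 0 < u → 0 < u ^ t
pos-^ {u} t u>0 = m^n>0 u {{>-nonZero u>0}} t

^-distribʳ-* : ∀ u v t → (u * v) ^ t ≡ u ^ t * v ^ t
^-distribʳ-* u v zero = refl
^-distribʳ-* u v (suc t) =
  trans (cong (u * v *_) (^-distribʳ-* u v t)) (interchange u v (u ^ t) (v ^ t))

map-unique⁺ : ∀ {A B : Set} (f : A → B) {xs : List A} →
  (∀ {u v} → u ∈ xs → v ∈ xs → f u ≡ f v → u ≡ v) → Unique xs → Unique (map f xs)
map-unique⁺ f inj [] = []
map-unique⁺ f {x ∷ xs} inj (x∉xs ∷ xs!) =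
  All.map⁺ (All.tabulate λ y∈xs fx≡fy → All.lookup x∉xs y∈xs (inj (here refl) (there y∈xs) fx≡fy))
  ∷ map-unique⁺ f (λ u∈xs v∈xs → inj (there u∈xs) (there v∈xs)) xs!

∈⇒≤sum : ∀ {z} {zs : List ℕ} → z ∈ zs → z ≤ sum zs
∈⇒≤sum {zs = z ∷ zs} (here refl) = m≤m+n z (sum zs)
∈⇒≤sum {zs = z ∷ zs} (there z'∈zs) = ≤-trans (∈⇒≤sum z'∈zs) (m≤n+m (sum zs) z)

sum-map-*ˡ : ∀ c (g : ℕ → ℕ) ys → sum (map (λ v → c * g v) ys) ≡ c * sum (map g ys)
sum-map-*ˡ c g [] = sym (*-zeroʳ c)
sum-map-*ˡ c g (y ∷ ys) =
  trans (cong (_+_ (c * g y)) (sum-map-*ˡ c g ys)) (sym (*-distribˡ-+ c (g y) (sum (map g ys))))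

sum-cartesianProduct : (f : ℕ → ℕ) → (∀ u v → f (u * v) ≡ f u * f v) → ∀ xs ys →
  sum (map (f ∘ uncurry _*_) (cartesianProduct xs ys)) ≡ sum (map f xs) * sum (map f ys)
sum-cartesianProduct f f-mul [] ys = refl
sum-cartesianProduct f f-mul (u ∷ xs) ys = begin
  sum (map g (map (u ,_) ys ++ cartesianProduct xs ys))
    ≡⟨ cong sum (map-++ g (map (u ,_) ys) (cartesianProduct xs ys)) ⟩
  sum (map g (map (u ,_) ys) ++ map g (cartesianProduct xs ys))
    ≡⟨ sum-++ (map g (map (u ,_) ys)) (map g (cartesianProduct xs ys)) ⟩
  sum (map g (map (u ,_) ys)) + sum (map g (cartesianProduct xs ys))
    ≡⟨ cong₂ _+_ (cong sum (trans (sym (map-∘ ys)) (map-cong (f-mul u) ys)))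
                 (sum-cartesianProduct f f-mul xs ys) ⟩
  sum (map (λ v → f u * f v) ys) + S xs * S ys
    ≡⟨ cong (_+ S xs * S ys) (sum-map-*ˡ (f u) f ys) ⟩
  f u * S ys + S xs * S ys
    ≡⟨ sym (*-distribʳ-+ (S ys) (f u) (S xs)) ⟩
  (f u + S xs) * S ys ∎
  where
  g : ℕ × ℕ → ℕ
  g = f ∘ uncurry _*_
  S : List ℕ → ℕ
  S zs = sum (map f zs)

divisor-pos : ∀ {d n} → 0 < n → d ∣ n → 0 < d
divisor-pos {zero} n>0 d∣n rewrite 0∣⇒≡0 d∣n = n>0
divisor-pos {suc d} _ _ = s≤s z≤n

∈-divisors⁺ : ∀ {d n} → 0 < n → d ∣ n → d ∈ divisors n
∈-divisors⁺ {zero} n>0 d∣n = ⊥-elim (<-irrefl refl (divisor-pos n>0 d∣n))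
∈-divisors⁺ {suc d} {n} n>0 d∣n =
  ∈-filter⁺ (_∣? n) (∈-applyUpTo⁺ suc (∣⇒≤ {{>-nonZero n>0}} d∣n)) d∣n

∈-divisors⁻ : ∀ {d} n → d ∈ divisors n → d ∣ n
∈-divisors⁻ n d∈ = proj₂ (∈-filter⁻ (_∣? n) {xs = applyUpTo suc n} d∈)

divisors-unique : ∀ n → Unique (divisors n)
divisors-unique n = Unique.filter⁺ (_∣? n)
  (Unique.applyUpTo⁺₁ suc n (λ i<j _ i≡j → <-irrefl (suc-injective i≡j) i<j))

coprime-∣ : ∀ {a c d e} → Coprime a c → d ∣ a → e ∣ c → Coprime d e
coprime-∣ a⊥c d∣a e∣c (i∣d , i∣e) = a⊥c (∣-trans i∣d d∣a , ∣-trans i∣e e∣c)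

coprime-*ˡ : ∀ {d a m} → Coprime d m → Coprime a m → Coprime (d * a) m
coprime-*ˡ {d} {a} d⊥m a⊥m {i} (i∣da , i∣m) = d⊥m (i∣d , i∣m)
  where
  i∣d : i ∣ d
  i∣d = coprime-divisor (λ (j∣i , j∣a) → a⊥m (j∣a , ∣-trans j∣i i∣m))
                        (subst (i ∣_) (*-comm d a) i∣da)

coprime-^ : ∀ {a m} k → Coprime a m → Coprime a (m ^ k)
coprime-^ {a} zero _ = Coprimality.sym (Coprimality.1-coprimeTo a)
coprime-^ (suc k) a⊥m =
  Coprimality.sym (coprime-*ˡ (Coprimality.sym a⊥m) (Coprimality.sym (coprime-^ k a⊥m)))

coprime-factorisation-unique : ∀ {a c d₁ d₂ e₁ e₂} → Coprime a c → 0 < a →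
  d₁ ∣ a → e₁ ∣ a → d₂ ∣ c → e₂ ∣ c → d₁ * d₂ ≡ e₁ * e₂ → d₁ ≡ e₁ × d₂ ≡ e₂
coprime-factorisation-unique {d₁ = d₁} {d₂} {e₁} {e₂} a⊥c a>0 d₁∣a e₁∣a d₂∣c e₂∣c eq =
  d₁≡e₁ , *-cancelˡ-≡ d₂ e₂ d₁ {{>-nonZero (divisor-pos a>0 d₁∣a)}} (trans eq (cong (_* e₂) (sym d₁≡e₁)))
  where
  d₁≡e₁ : d₁ ≡ e₁
  d₁≡e₁ = ∣-antisym
    (coprime-divisor (coprime-∣ a⊥c d₁∣a e₂∣c) (subst (d₁ ∣_) (trans eq (*-comm e₁ e₂)) (m∣m*n d₂)))
    (coprime-divisor (coprime-∣ a⊥c e₁∣a d₂∣c) (subst (e₁ ∣_) (trans (sym eq) (*-comm d₁ d₂)) (m∣m*n e₂)))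

coprime-factorisation : ∀ {a c z} → Coprime a c → 0 < a → z ∣ a * c →
  Σ[ d ∈ ℕ ] Σ[ e ∈ ℕ ] d ∣ a × e ∣ c × z ≡ d * e
coprime-factorisation {a} {c} {z} a⊥c a>0 z∣ac = g , e , g∣a , e∣c , z≡ge
  where
  g : ℕ
  g = gcd z a
  instance
    g≢0 : NonZero g
    g≢0 = ≢-nonZero (gcd[m,n]≢0 z a (inj₂ (λ a≡0 → <-irrefl (sym a≡0) a>0)))
  g∣a : g ∣ a
  g∣a = gcd[m,n]∣n z a
  e : ℕ
  e = quotient (gcd[m,n]∣m z a)
  a′ : ℕ
  a′ = quotient g∣a
  z≡ge : z ≡ g * e
  z≡ge = m∣n⇒n≡m*quotient (gcd[m,n]∣m z a)
  a≡ga′ : a ≡ g * a′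
  a≡ga′ = m∣n⇒n≡m*quotient g∣a
  gcd[e,a′]≡1 : gcd e a′ ≡ 1
  gcd[e,a′]≡1 = *-cancelˡ-≡ (gcd e a′) 1 g (begin
    g * gcd e a′   ≡⟨ c*gcd[m,n]≡gcd[cm,cn] g e a′ ⟩
    gcd (g * e) (g * a′) ≡⟨ cong₂ gcd (sym z≡ge) (sym a≡ga′) ⟩
    g              ≡⟨ sym (*-identityʳ g) ⟩
    g * 1          ∎)
  e∣a′c : e ∣ a′ * c
  e∣a′c = *-cancelˡ-∣ g (subst₂ _∣_ z≡ge (trans (cong (_* c) a≡ga′) (*-assoc g a′ c)) z∣ac)
  e∣c : e ∣ c
  e∣c = coprime-divisor (gcd≡1⇒coprime gcd[e,a′]≡1) e∣a′c

divisors-*-↭ : ∀ {a c} → Coprime a c → 0 < a → 0 < c →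
  divisors (a * c) ↭ map (uncurry _*_) (cartesianProduct (divisors a) (divisors c))
divisors-*-↭ {a} {c} a⊥c a>0 c>0 =
  ∼bag⇒↭ (unique∧set⇒bag (divisors-unique (a * c)) products-unique (mk⇔ to from))
  where
  P : List (ℕ × ℕ)
  P = cartesianProduct (divisors a) (divisors c)
  product-injective : ∀ {u v} → u ∈ P → v ∈ P → uncurry _*_ u ≡ uncurry _*_ v → u ≡ v
  product-injective {d₁ , d₂} {e₁ , e₂} u∈P v∈P eq
    with d₁∈ , d₂∈ ← ∈-cartesianProduct⁻ (divisors a) (divisors c) u∈P
       | e₁∈ , e₂∈ ← ∈-cartesianProduct⁻ (divisors a) (divisors c) v∈P
    with refl , refl ← coprime-factorisation-unique a⊥c a>0
           (∈-divisors⁻ a d₁∈) (∈-divisors⁻ a e₁∈) (∈-divisors⁻ c d₂∈) (∈-divisors⁻ c e₂∈) eq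
    = refl
  products-unique : Unique (map (uncurry _*_) P)
  products-unique = map-unique⁺ (uncurry _*_) product-injective
    (Unique.cartesianProduct⁺ (divisors-unique a) (divisors-unique c))
  to : ∀ {z} → z ∈ divisors (a * c) → z ∈ map (uncurry _*_) P
  to z∈ with d , e , d∣a , e∣c , refl ← coprime-factorisation a⊥c a>0 (∈-divisors⁻ (a * c) z∈) =
    ∈-map⁺ (uncurry _*_) (∈-cartesianProduct⁺ (∈-divisors⁺ a>0 d∣a) (∈-divisors⁺ c>0 e∣c))
  from : ∀ {z} → z ∈ map (uncurry _*_) P → z ∈ divisors (a * c)
  from z∈ with (d , e) , de∈P , refl ← ∈-map⁻ (uncurry _*_) z∈
    with d∈ , e∈ ← ∈-cartesianProduct⁻ (divisors a) (divisors c) de∈P =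
    ∈-divisors⁺ (pos-* a>0 c>0) (*-pres-∣ (∈-divisors⁻ a d∈) (∈-divisors⁻ c e∈))

σ-multiplicative : ∀ x {a c} → Coprime a c → 0 < a → 0 < c → σ x (a * c) ≡ σ x a * σ x c
σ-multiplicative x {a} {c} a⊥c a>0 c>0 = begin
  sum (map (_^ x) (divisors (a * c)))
    ≡⟨ sum-↭ (map⁺ (_^ x) (divisors-*-↭ a⊥c a>0 c>0)) ⟩
  sum (map (_^ x) (map (uncurry _*_) P))
    ≡⟨ cong sum (sym (map-∘ P)) ⟩
  sum (map ((_^ x) ∘ uncurry _*_) P)
    ≡⟨ sum-cartesianProduct (_^ x) (λ u v → ^-distribʳ-* u v x) (divisors a) (divisors c) ⟩
  σ x a * σ x c ∎
  where
  P : List (ℕ × ℕ)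
  P = cartesianProduct (divisors a) (divisors c)

σ-pos : ∀ x {n} → 0 < n → 0 < σ x n
σ-pos x n>0 = ≤-trans (≤-reflexive (sym (^-zeroˡ x)))
  (∈⇒≤sum (∈-map⁺ (_^ x) (∈-divisors⁺ n>0 (1∣ _))))

-- If n = a b with a the largest divisor of n coprime to m, then a is coprime
-- to b: gcd(a, b) · a divides n and is coprime to m, so it is at most a.
largest-coprime-divisor-⊥-cofactor : ∀ {a b n m} → 0 < n → n ≡ a * b →
  IsLargestCoprimeDivisor a n m → Coprime a b
largest-coprime-divisor-⊥-cofactor {a} {b} {n} {m} n>0 n≡ab (a∣n , a⊥m , largest) =
  gcd≡1⇒coprime (≤-antisym (*-cancelʳ-≤ g 1 a {{>-nonZero a>0}} ga≤1a) g>0)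
  where
  g : ℕ
  g = gcd a b
  a>0 : 0 < a
  a>0 = divisor-pos n>0 a∣n
  g>0 : 0 < g
  g>0 = n≢0⇒n>0 (gcd[m,n]≢0 a b (inj₁ (n>0⇒n≢0 a>0)))
  g⊥m : Coprime g m
  g⊥m (i∣g , i∣m) = a⊥m (∣-trans i∣g (gcd[m,n]∣m a b) , i∣m)
  ga∣n : g * a ∣ n
  ga∣n = subst (g * a ∣_) (trans (*-comm b a) (sym n≡ab)) (*-monoˡ-∣ a (gcd[m,n]∣n a b))
  ga≤1a : g * a ≤ 1 * a
  ga≤1a = subst (g * a ≤_) (sym (*-identityˡ a)) (largest (g * a) ga∣n (coprime-*ˡ g⊥m a⊥m))

largest-coprime-divisor-⊥-cofactor-* : ∀ {a b n m} t → 0 < n → n ≡ a * b →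
  IsLargestCoprimeDivisor a n m → Coprime a (b * m ^ t)
largest-coprime-divisor-⊥-cofactor-* t n>0 n≡ab L@(_ , a⊥m , _) =
  Coprimality.sym (coprime-*ˡ
    (Coprimality.sym (largest-coprime-divisor-⊥-cofactor n>0 n≡ab L))
    (Coprimality.sym (coprime-^ t a⊥m)))

frac : ℕ → ℕ → ℚ
frac u v = ⟦ u ⟧ ÷ₜ ⟦ v ⟧

-- p is the fraction a / b (b > 0), compared as an unnormalised rational; this
-- lets fractions be manipulated by cross-multiplication in ℕ.
Represents : ℚ → ℕ → ℕ → Set
Represents p a b = toℚᵘ p ≃ mkℚᵘ (+ a) (pred b)

represents-⟦⟧ : ∀ u → Represents ⟦ u ⟧ u 1
represents-⟦⟧ u = toℚᵘ-fromℚᵘ (mkℚᵘ (+ u) 0)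

represents-1/ : ∀ q {{_ : ℚ.NonZero q}} c d →
  Represents q (suc c) (suc d) → Represents (1/ q) (suc d) (suc c)
represents-1/ (mkℚ +[1+ n ] e _) c d (*≡* eq) =
  *≡* (trans (ℤ.*-comm +[1+ e ] +[1+ c ]) (trans (sym eq) (ℤ.*-comm +[1+ n ] +[1+ d ])))
represents-1/ (mkℚ -[1+ n ] e _) c d (*≡* ())

represents-÷ₜ : ∀ p q {a b c d} → Represents p a b → Represents q c d →
  0 < b → 0 < c → 0 < d → Represents (p ÷ₜ q) (a * d) (b * c)
represents-÷ₜ p q {c = suc _} hp hq _ _ _ with q ℚ.≟ 0ℚ
represents-÷ₜ p q {c = suc _} hp (*≡* ()) _ _ _ | yes refl
represents-÷ₜ p q {a} {suc b} {suc c} {suc d} hp hq _ _ _ | no q≢0 =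
  ℚᵘ.≃-trans (toℚᵘ-homo-* p (1/ q))
    (ℚᵘ.≃-trans (ℚᵘ.*-cong hp (represents-1/ q c d hq))
      (*≡* (cong (ℤ._* (+ (suc b * suc c))) (sym (ℤ.pos-* a (suc d))))))
  where instance _ = ℚ.≢-nonZero q≢0

represents-frac : ∀ u {v} → 0 < v → Represents (frac u v) u v
represents-frac u {v} v>0 = subst₂ (Represents (frac u v)) (*-identityʳ u) (*-identityˡ v)
  (represents-÷ₜ ⟦ u ⟧ ⟦ v ⟧ (represents-⟦⟧ u) (represents-⟦⟧ v) (s≤s z≤n) v>0 (s≤s z≤n))

represents-unique : ∀ p q {a b c d} → Represents p a b → Represents q c d →
  0 < b → 0 < d → a * d ≡ c * b → p ≡ q
represents-unique p q {a} {suc b} {c} {suc d} hp hq _ _ ad≡cb =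
  toℚᵘ-injective (ℚᵘ.≃-trans hp (ℚᵘ.≃-trans
    (*≡* (trans (sym (ℤ.pos-* a (suc d))) (trans (cong +_ ad≡cb) (ℤ.pos-* c (suc b)))))
    (ℚᵘ.≃-sym hq)))

I-factorisation : ∀ x t {n m a b} → 0 < n → 0 < m → 0 < b → n ≡ a * b →
  IsLargestCoprimeDivisor a n m →
  Represents (I x (n * m ^ t)) (σ x a * σ x (b * m ^ t)) (a ^ x * (b * m ^ t) ^ x)
I-factorisation x t {n} {m} {a} {b} n>0 m>0 b>0 n≡ab L =
  subst₂ (Represents (I x (n * m ^ t)))
    (trans (cong (σ x) n·mᵗ≡a·c)
      (σ-multiplicative x (largest-coprime-divisor-⊥-cofactor-* t n>0 n≡ab L) a>0 c>0))
    (trans (cong (_^ x) n·mᵗ≡a·c) (^-distribʳ-* a c x))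
    (represents-frac (σ x (n * m ^ t)) (pos-^ x (pos-* n>0 (pos-^ t m>0))))
  where
  c : ℕ
  c = b * m ^ t
  a>0 : 0 < a
  a>0 = divisor-pos n>0 (proj₁ L)
  c>0 : 0 < c
  c>0 = pos-* b>0 (pos-^ t m>0)
  n·mᵗ≡a·c : n * m ^ t ≡ a * c
  n·mᵗ≡a·c = trans (cong (_* m ^ t) n≡ab) (*-assoc a b (m ^ t))

I-ratio : ∀ x k j {n m a b} → 0 < n → 0 < m → 0 < b → n ≡ a * b →
  IsLargestCoprimeDivisor a n m →
  I x (n * m ^ k) ÷ₜ I x (n * m ^ j)
    ≡ frac (σ x (b * m ^ k) * (b * m ^ j) ^ x) ((b * m ^ k) ^ x * σ x (b * m ^ j))
I-ratio x k j {n} {m} {a} {b} n>0 m>0 b>0 n≡ab L =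
  represents-unique _ _ quotient-rep
    (represents-frac (σ x (c k) * c j ^ x) (pos-* (cˣ>0 k) (σc>0 j)))
    (pos-* (pos-* aˣ>0 (cˣ>0 k)) (pos-* σa>0 (σc>0 j)))
    (pos-* (cˣ>0 k) (σc>0 j))
    (solve 6 (λ A P Sₖ Sⱼ Qₖ Qⱼ →
        ((A :* Sₖ) :* (P :* Qⱼ)) :* (Qₖ :* Sⱼ) := (Sₖ :* Qⱼ) :* ((P :* Qₖ) :* (A :* Sⱼ)))
      refl (σ x a) (a ^ x) (σ x (c k)) (σ x (c j)) (c k ^ x) (c j ^ x))
  where
  open +-*-Solver using (solve; _:*_; _:=_)
  c : ℕ → ℕ
  c t = b * m ^ t
  a>0 : 0 < a
  a>0 = divisor-pos n>0 (proj₁ L)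
  c>0 : ∀ t → 0 < c t
  c>0 t = pos-* b>0 (pos-^ t m>0)
  σa>0 : 0 < σ x a
  σa>0 = σ-pos x a>0
  aˣ>0 : 0 < a ^ x
  aˣ>0 = pos-^ x a>0
  σc>0 : ∀ t → 0 < σ x (c t)
  σc>0 t = σ-pos x (c>0 t)
  cˣ>0 : ∀ t → 0 < c t ^ x
  cˣ>0 t = pos-^ x (c>0 t)
  quotient-rep : Represents (I x (n * m ^ k) ÷ₜ I x (n * m ^ j))
    ((σ x a * σ x (c k)) * (a ^ x * c j ^ x)) ((a ^ x * c k ^ x) * (σ x a * σ x (c j)))
  quotient-rep = represents-÷ₜ _ _
    (I-factorisation x k n>0 m>0 b>0 n≡ab L) (I-factorisation x j n>0 m>0 b>0 n≡ab L)
    (pos-* aˣ>0 (cˣ>0 k)) (pos-* σa>0 (σc>0 j)) (pos-* aˣ>0 (cˣ>0 j))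

-- Both quotients equal the fraction of I-ratio, which depends only on x, b, m, k, j.
mainTheorem10 : (x n₁ n₂ m k j a₁ a₂ b : ℕ) →
    x ≥ 1 → n₁ ≥ 1 → n₂ ≥ 1 → m ≥ 1 → k ≥ 1 → b ≥ 1 →
    n₁ ≡ a₁ * b → n₂ ≡ a₂ * b →
    IsLargestCoprimeDivisor a₁ n₁ m → IsLargestCoprimeDivisor a₂ n₂ m →
    I x (n₁ * m ^ k) ÷ₜ I x (n₁ * m ^ j) ≡ I x (n₂ * m ^ k) ÷ₜ I x (n₂ * m ^ j)
mainTheorem10 x n₁ n₂ m k j a₁ a₂ b _ n₁>0 n₂>0 m>0 _ b>0 n₁≡a₁b n₂≡a₂b L₁ L₂ =
  trans (I-ratio x k j n₁>0 m>0 b>0 n₁≡a₁b L₁) (sym (I-ratio x k j n₂>0 m>0 b>0 n₂≡a₂b L₂))
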